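{- Let an inference rule be "We may append $+d\,q$ to $P$ if $C$", where $C$ is an applicability condition. If $C$ is $P$-disciplined, then the inference rule is stable (and hence applicability persistent).
   Context: Literals are propositions or their negations. A defeasible theory $D=(F,R,>)$ consists of a finite set $F$ of literals, a finite set $R$ of rules (each with a finite antecedent set of literals, a type strict/defeasible/defeater, and a consequent literal) and an acyclic relation $>$ on $R$. A conclusion has the form $+d\,q$ or $-d\,q$ with $d$ a tag and $q$ a literal. An inference rule "We may append $\pm d\,q$ to $P$ if $C$" has tag $\pm d$ and applicability condition $C=C(D,q,P)$. A proof from $D$ (in a defeasible logic, i.e. a finite set of inference rules) is a finite sequence of conclusions each appendable by some inference rule to the sequence preceding it. An applicability condition is a first-order formula in negation normal form (negation $\neg$ applied only to atomic formulas, other connectives $\wedge,\vee,\exists,\forall$; quantified variables range over syntactic elements of $D$ or numbers) whose atomic formulas are: comparisons involving elements of $D$; arithmetic and set comparisons (not involving $P$); membership tests $+d'p\in P$ or $-d'p\in P$ involving the proof so far; and membership tests $\pm d'p\in X$ with $X$ a pre-defined set of conclusions computed from $D$ beforehand (e.g. a closure). $C$ is $P$-disciplined if $P$ occurs in $C$ only in expressions of the form $\pm d'\,p\in P$ and each such occurrence is in a positive context (not under $\neg$). An inference rule with condition $C$ is stable if for every proof $P$ and every proof $Q$ containing $P$ as a subsequence, $C(P)\rightarrow C(Q)$; it is applicability persistent if this holds whenever $P$ is a prefix of $Q$. -}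

module Defs where

open import Data.List using (List; []; _∷_; _++_; _∷ʳ_)
open import Data.List.Membership.Propositional using (_∈_)
open import Data.List.Relation.Binary.Sublist.Propositional using (_⊆_)
open import Data.Product using (Σ; ∃; _×_; _,_)
open import Data.Sum using (_⊎_)
open import Relation.Nullary using (¬_)
open import Relation.Binary.Construct.Closure.Transitive using (TransClosure)
open import Relation.Binary.PropositionalEquality using (_≡_)

data Literal (Prop : Set) : Set where
  pos : Prop → Literal Prop
  neg : Prop → Literal Prop

data RuleType : Set where
  strict defeasible defeater : RuleType

record Rule (Prop : Set) : Set where
  constructor rule
  field
    antecedent : List (Literal Prop)
    type       : RuleType
    consequent : Literal Prop

record Theory (Prop : Set) : Set where
  field
    facts   : List (Literal Prop)
    rules   : List (Rule Prop)
    sup     : List (Rule Prop × Rule Prop)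
    sup⊆R   : ∀ {r s} → (r , s) ∈ sup → (r ∈ rules) × (s ∈ rules)
    acyclic : ∀ r → ¬ TransClosure (λ r₁ r₂ → (r₁ , r₂) ∈ sup) r r

data Sign : Set where
  plus minus : Sign

record Conclusion (Tag Lit : Set) : Set where
  constructor ⟨_,_,_⟩
  field
    sign : Sign
    tag  : Tag
    lit  : Lit

-- Prop  : propositions;  Tag : proof tags d
--  Sort, Dom : the sorts over which quantified variables range
--              (syntactic elements of theories, numbers, tags, ...)
--  Atom, ⟦_⟧ᵃ : the (ground) atomic formulas that do NOT involve the proof P
--              (comparisons, arithmetic/set comparisons, membership in
--               pre-computed sets X), with their truth value.

record Language : Set₁ where
  field
    Prop  : Set
    Tag   : Set
    Sort  : Set
    Dom   : Sort → Set
    Atom  : Set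
    ⟦_⟧ᵃ  : Atom → Set

module _ (𝓛 : Language) where
  open Language 𝓛

  Lit : Set
  Lit = Literal Prop

  Concl : Set
  Concl = Conclusion Tag Lit

  Seq : Set
  Seq = List Concl

  -- formulas in negation normal form (variables handled by HOAS)
  data Formula : Set where
    atom  : Atom → Formula
    ¬atom : Atom → Formula
    inP   : Concl → Formula
    ¬inP  : Concl → Formula
    _∧'_  : Formula → Formula → Formula
    _∨'_  : Formula → Formula → Formula
    ∃'    : (s : Sort) → (Dom s → Formula) → Formula
    ∀'    : (s : Sort) → (Dom s → Formula) → Formula

  ⟦_⟧ : Formula → Seq → Set
  ⟦ atom a ⟧  P = ⟦ a ⟧ᵃ
  ⟦ ¬atom a ⟧ P = ¬ ⟦ a ⟧ᵃ
  ⟦ inP c ⟧   P = c ∈ P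
  ⟦ ¬inP c ⟧  P = ¬ (c ∈ P)
  ⟦ φ ∧' ψ ⟧  P = ⟦ φ ⟧ P × ⟦ ψ ⟧ P
  ⟦ φ ∨' ψ ⟧  P = ⟦ φ ⟧ P ⊎ ⟦ ψ ⟧ P
  ⟦ ∃' s f ⟧  P = Σ (Dom s) (λ x → ⟦ f x ⟧ P)
  ⟦ ∀' s f ⟧  P = (x : Dom s) → ⟦ f x ⟧ P

  -- P-disciplined: P only occurs in membership tests ±d'p ∈ P, all in
  -- positive context (no negated membership test anywhere)
  data Disciplined : Formula → Set where
    atom  : ∀ a → Disciplined (atom a)
    ¬atom : ∀ a → Disciplined (¬atom a)
    inP   : ∀ c → Disciplined (inP c)
    _∧'_  : ∀ {φ ψ} → Disciplined φ → Disciplined ψ → Disciplined (φ ∧' ψ)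
    _∨'_  : ∀ {φ ψ} → Disciplined φ → Disciplined ψ → Disciplined (φ ∨' ψ)
    ∃'    : ∀ {s f} → (∀ x → Disciplined (f x)) → Disciplined (∃' s f)
    ∀'    : ∀ {s f} → (∀ x → Disciplined (f x)) → Disciplined (∀' s f)

  Condition : Set
  Condition = Theory Prop → Lit → Formula

  record InferenceRule : Set where
    constructor rule
    field
      sign : Sign
      tag  : Tag
      cond : Condition

  DefeasibleLogic : Set
  DefeasibleLogic = List InferenceRule

  data IsProof (ℒ : DefeasibleLogic) (D : Theory Prop) : Seq → Set where
    []     : IsProof ℒ D []
    append : ∀ {P c} (ρ : InferenceRule) → IsProof ℒ D P → ρ ∈ ℒ
           → InferenceRule.sign ρ ≡ Conclusion.sign c
           → InferenceRule.tag ρ ≡ Conclusion.tag c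
           → ⟦ InferenceRule.cond ρ D (Conclusion.lit c) ⟧ P
           → IsProof ℒ D (P ∷ʳ c)

  Stable : DefeasibleLogic → InferenceRule → Set
  Stable ℒ ρ = ∀ (D : Theory Prop) (q : Lit) (P Q : Seq)
             → IsProof ℒ D P → IsProof ℒ D Q → P ⊆ Q
             → ⟦ InferenceRule.cond ρ D q ⟧ P → ⟦ InferenceRule.cond ρ D q ⟧ Q

  ApplicabilityPersistent : DefeasibleLogic → InferenceRule → Set
  ApplicabilityPersistent ℒ ρ = ∀ (D : Theory Prop) (q : Lit) (P R : Seq)
             → IsProof ℒ D P → IsProof ℒ D (P ++ R)
             → ⟦ InferenceRule.cond ρ D q ⟧ P → ⟦ InferenceRule.cond ρ D q ⟧ (P ++ R)

module Submission where

open import Defs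
open import Data.Product using (_×_; _,_)
open import Data.Sum using (inj₁; inj₂)
open import Data.List using (_++_)
open import Data.List.Relation.Binary.Sublist.Propositional using (_⊆_)
open import Data.List.Relation.Binary.Sublist.Propositional.Properties using (Any-resp-⊆)
open import Data.List.Membership.Propositional using (_∈_)
open import Data.List.Membership.Propositional.Properties using (∈-++⁺ˡ)
open import Relation.Binary.PropositionalEquality using (_≡_)

-- A disciplined condition reads P only through positive tests c ∈ P, so its
-- truth is monotone in the set of conclusions of P; neither the order of P
-- nor the fact that P and Q are proofs plays any role.

module _ (𝓛 : Language) where

  ⟦⟧-mono : ∀ {φ} → Disciplined 𝓛 φ → ∀ {P Q : Seq 𝓛}
          → (∀ {c} → c ∈ P → c ∈ Q) → ⟦_⟧ 𝓛 φ P → ⟦_⟧ 𝓛 φ Q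
  ⟦⟧-mono (atom a)  P⊆Q h        = h
  ⟦⟧-mono (¬atom a) P⊆Q h        = h
  ⟦⟧-mono (inP c)   P⊆Q c∈P      = P⊆Q c∈P
  ⟦⟧-mono (dφ ∧' dψ) P⊆Q (h , k) = ⟦⟧-mono dφ P⊆Q h , ⟦⟧-mono dψ P⊆Q k
  ⟦⟧-mono (dφ ∨' dψ) P⊆Q (inj₁ h) = inj₁ (⟦⟧-mono dφ P⊆Q h)
  ⟦⟧-mono (dφ ∨' dψ) P⊆Q (inj₂ k) = inj₂ (⟦⟧-mono dψ P⊆Q k)
  ⟦⟧-mono (∃' df)   P⊆Q (x , h)  = x , ⟦⟧-mono (df x) P⊆Q h
  ⟦⟧-mono (∀' df)   P⊆Q h        = λ x → ⟦⟧-mono (df x) P⊆Q (h x)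

  module _ (ℒ : DefeasibleLogic 𝓛) (ρ : InferenceRule 𝓛)
           (disciplined : ∀ D q → Disciplined 𝓛 (InferenceRule.cond ρ D q)) where

    disciplined⇒stable : Stable 𝓛 ℒ ρ
    disciplined⇒stable D q P Q _ _ P⊆Q =
      ⟦⟧-mono (disciplined D q) (Any-resp-⊆ P⊆Q)

    disciplined⇒applicabilityPersistent : ApplicabilityPersistent 𝓛 ℒ ρ
    disciplined⇒applicabilityPersistent D q P R _ _ =
      ⟦⟧-mono (disciplined D q) ∈-++⁺ˡ

proposition2 : (𝓛 : Language) (ℒ : DefeasibleLogic 𝓛) (ρ : InferenceRule 𝓛)
    → InferenceRule.sign ρ ≡ plus
    → (∀ D q → Disciplined 𝓛 (InferenceRule.cond ρ D q))
    → Stable 𝓛 ℒ ρ × ApplicabilityPersistent 𝓛 ℒ ρ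
proposition2 𝓛 ℒ ρ _ disciplined =
  disciplined⇒stable 𝓛 ℒ ρ disciplined ,
  disciplined⇒applicabilityPersistent 𝓛 ℒ ρ disciplined
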